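{- Let $\mathcal{A}$ be a finite totally ordered alphabet and let $w\in\mathcal{A}^{+}$ be a Lyndon word with $|w|\ge F_n$ for some $n\ge3$. Then $\mathcal{L}(w)\ge n$. Furthermore, if $\mathcal{L}(w)=n$, then $w$ is a Fibonacci Lyndon word of length $F_n$.
   Context: Lyndon words: nonempty primitive words strictly smallest in their conjugacy class under the lexicographic order. $\mathcal{L}(w)$ is the number of distinct Lyndon factors of $w$. Fibonacci numbers: $F_0=0,F_1=1,F_n=F_{n-1}+F_{n-2}$. For letters $\mathtt{a}<\mathtt{b}$ of $\mathcal{A}$, set $f_1=\mathtt{b}$, $f_2=\mathtt{a}$, $f_n=f_{n-1}f_{n-2}$; for $n\ge3$ let $p_n$ be $f_n$ with its last two letters removed; with $c$ the morphism swapping $\mathtt{a},\mathtt{b}$, the Fibonacci Lyndon words of length $F_n$ over $\{\mathtt{a},\mathtt{b}\}$ are $\mathtt{a}p_n\mathtt{b}$ and $\mathtt{a}c(p_n)\mathtt{b}$; a Fibonacci Lyndon word of length $F_n$ is one of these for some letters $\mathtt{a}<\mathtt{b}$. -}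

module Defs where

open import Data.Nat using (ℕ; zero; suc; _+_; _∸_)
open import Data.Fin using (Fin; _<_; _≟_)
open import Data.List using (List; []; _∷_; _++_; length; take; map; concat; replicate)
open import Data.List.Membership.Propositional using (_∈_)
open import Data.List.Relation.Unary.Unique.Propositional using (Unique)
open import Data.Product using (Σ; ∃; _×_; _,_)
open import Data.Sum using (_⊎_)
open import Data.Unit using (⊤)
open import Data.Empty using (⊥)
open import Data.Bool using (if_then_else_)
open import Relation.Nullary using (¬_)
open import Relation.Nullary.Decidable using (⌊_⌋)
open import Relation.Binary.PropositionalEquality using (_≡_; _≢_)
open import Function.Bundles using (_⇔_)

Word : ℕ → Set
Word k = List (Fin k)

data _<lex_ {k : ℕ} : Word k → Word k → Set where
  []<∷  : ∀ {y ys} → [] <lex (y ∷ ys)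
  here  : ∀ {x y xs ys} → x < y → (x ∷ xs) <lex (y ∷ ys)
  there : ∀ {x xs ys} → xs <lex ys → (x ∷ xs) <lex (x ∷ ys)

Primitive : ∀ {k} → Word k → Set
Primitive w = ∀ u m → w ≡ concat (replicate m u) → m ≡ 1

Conjugate : ∀ {k} → Word k → Word k → Set
Conjugate w v = ∃ λ x → ∃ λ y → w ≡ x ++ y × v ≡ y ++ x

Lyndon : ∀ {k} → Word k → Set
Lyndon w = (w ≢ []) × Primitive w × (∀ v → Conjugate w v → v ≢ w → w <lex v)

Factor : ∀ {k} → Word k → Word k → Set
Factor u w = ∃ λ x → ∃ λ y → w ≡ x ++ u ++ y

NumLyndonFactors : ∀ {k} → Word k → ℕ → Set
NumLyndonFactors {k} w m =
  Σ (List (Word k)) λ ls → Unique ls × length ls ≡ m ×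
    (∀ u → (u ∈ ls) ⇔ (Lyndon u × Factor u w))

fib : ℕ → ℕ
fib zero = zero
fib (suc zero) = suc zero
fib (suc (suc n)) = fib (suc n) + fib n

fibWord : ∀ {k} → Fin k → Fin k → ℕ → Word k
fibWord a b zero = []
fibWord a b (suc zero) = b ∷ []
fibWord a b (suc (suc zero)) = a ∷ []
fibWord a b (suc (suc (suc n))) = fibWord a b (suc (suc n)) ++ fibWord a b (suc n)

pWord : ∀ {k} → Fin k → Fin k → ℕ → Word k
pWord a b n = take (length (fibWord a b n) ∸ 2) (fibWord a b n)

swapLetter : ∀ {k} → Fin k → Fin k → Fin k → Fin k
swapLetter a b x = if ⌊ x ≟ a ⌋ then b else (if ⌊ x ≟ b ⌋ then a else x)

cMorph : ∀ {k} → Fin k → Fin k → Word k → Word k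
cMorph a b = map (swapLetter a b)

FibonacciLyndon : ∀ {k} → ℕ → Word k → Set
FibonacciLyndon {k} n w = ∃ λ (a : Fin k) → ∃ λ (b : Fin k) → a < b ×
  (w ≡ a ∷ (pWord a b n ++ b ∷ []) ⊎ w ≡ a ∷ (cMorph a b (pWord a b n) ++ b ∷ []))

module Submission where

-- Everything runs along the standard factorisation w = uv of a Lyndon word into two
-- Lyndon words (v the lexicographically least proper suffix).  The lower
-- bound  |w| > F_n ⇒ 𝓛(w) ≥ n + 1  is by induction: a long standard factor supplies
-- n factors and w adds itself; otherwise both factors are long and distinct.
-- In the extremal case the standard factors have lengths F_(n-1) and F_(n-2), the
-- shorter occurs in the longer, and both are extremal; by induction they are
-- Fibonacci Lyndon words over the same letters, and the identities
-- p_(n+2) = p_(n+1) d p_n = p_n d′ p_(n+1)  (d, d′ ∈ {ab, ba}) identify w.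

open import Defs
open import Data.Nat using (ℕ; zero; suc; _+_; _∸_; _≤_; _<_; z≤n; s≤s; _<?_)
open import Data.Nat.Properties
open import Data.Fin using (Fin) renaming (_<_ to _<F_; _≟_ to _≟F_)
import Data.Fin.Properties as FP
open import Data.List using (List; []; _∷_; _++_; length; take; map; concat; replicate)
import Data.List.Properties as LP
open import Data.List.Relation.Unary.All using (All; []; _∷_)
import Data.List.Relation.Unary.All as All
import Data.List.Relation.Unary.All.Properties as AllP
open import Data.List.Relation.Unary.Unique.Propositional using (Unique)
open import Data.List.Relation.Unary.AllPairs using ([]; _∷_)
open import Data.List.Membership.Propositional using (_∈_)
open import Data.List.Membership.Propositional.Properties using (∈-∃++; ∈-++⁻; ∈-++⁺ˡ; ∈-++⁺ʳ)
open import Data.List.Relation.Unary.Any using (here; there)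
open import Data.Product using (Σ; ∃; _×_; _,_; proj₁; proj₂)
open import Data.Sum using (_⊎_; inj₁; inj₂)
open import Data.Empty using (⊥; ⊥-elim)
open import Data.Unit using (⊤; tt)
open import Relation.Nullary using (¬_; Dec; yes; no)
open import Relation.Binary using (tri<; tri≈; tri>)
open import Relation.Binary.PropositionalEquality using (_≡_; _≢_; refl; sym; trans; cong; cong₂; subst; subst₂; module ≡-Reasoning)
open import Function.Bundles using (Equivalence)

variable
  k : ℕ

++-equidivisible : ∀ {A : Set} (a b c d : List A) → a ++ b ≡ c ++ d →
  (∃ λ r → c ≡ a ++ r × b ≡ r ++ d) ⊎ (∃ λ r → a ≡ c ++ r × d ≡ r ++ b)
++-equidivisible [] b c d eq = inj₁ (c , refl , eq)
++-equidivisible (x ∷ a) b [] d eq = inj₂ (x ∷ a , refl , sym eq)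
++-equidivisible (x ∷ a) b (y ∷ c) d eq with LP.∷-injective eq
... | refl , eq′ with ++-equidivisible a b c d eq′
... | inj₁ (r , e₁ , e₂) = inj₁ (r , cong (x ∷_) e₁ , e₂)
... | inj₂ (r , e₁ , e₂) = inj₂ (r , cong (x ∷_) e₁ , e₂)

nonempty⇒length≥1 : ∀ {A : Set} (x : List A) → x ≢ [] → 1 ≤ length x
nonempty⇒length≥1 [] x≢[] = ⊥-elim (x≢[] refl)
nonempty⇒length≥1 (_ ∷ _) _ = s≤s z≤n

length≥1⇒nonempty : ∀ {A : Set} (x : List A) → 1 ≤ length x → x ≢ []
length≥1⇒nonempty (_ ∷ _) _ ()

length-<-++ : ∀ {A : Set} (x s : List A) → x ≢ [] → length s < length (x ++ s)
length-<-++ [] s x≢[] = ⊥-elim (x≢[] refl)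
length-<-++ (c ∷ x) s _ = s≤s (LP.length-++-≤ʳ s {x})

<lex-irrefl : ∀ {u : Word k} → ¬ (u <lex u)
<lex-irrefl (here x<x) = FP.<-irrefl refl x<x
<lex-irrefl (there p) = <lex-irrefl p

<lex-asym : ∀ {u v : Word k} → u <lex v → v <lex u → ⊥
<lex-asym []<∷ ()
<lex-asym (here p) (here q) = FP.<-asym p q
<lex-asym (here p) (there q) = FP.<-irrefl refl p
<lex-asym (there p) (here q) = FP.<-irrefl refl q
<lex-asym (there p) (there q) = <lex-asym p q

<lex⇒≢ : ∀ {u v : Word k} → u <lex v → v ≢ u
<lex⇒≢ p refl = <lex-irrefl p

<lex-trans : ∀ {u v w : Word k} → u <lex v → v <lex w → u <lex w
<lex-trans []<∷ (here q) = []<∷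
<lex-trans []<∷ (there q) = []<∷
<lex-trans (here p) (here q) = here (FP.<-trans p q)
<lex-trans (here p) (there q) = here p
<lex-trans (there p) (here q) = here q
<lex-trans (there p) (there q) = there (<lex-trans p q)

<lex-trichotomy : (u v : Word k) → u <lex v ⊎ u ≡ v ⊎ v <lex u
<lex-trichotomy [] [] = inj₂ (inj₁ refl)
<lex-trichotomy [] (y ∷ v) = inj₁ []<∷
<lex-trichotomy (x ∷ u) [] = inj₂ (inj₂ []<∷)
<lex-trichotomy (x ∷ u) (y ∷ v) with FP.<-cmp x y
... | tri< p _ _ = inj₁ (here p)
... | tri> _ _ p = inj₂ (inj₂ (here p))
... | tri≈ _ refl _ with <lex-trichotomy u v
... | inj₁ p = inj₁ (there p)
... | inj₂ (inj₁ refl) = inj₂ (inj₁ refl)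
... | inj₂ (inj₂ p) = inj₂ (inj₂ (there p))

_≤lex_ : Word k → Word k → Set
u ≤lex v = u <lex v ⊎ u ≡ v

≤lex-trans : ∀ {u v w : Word k} → u ≤lex v → v ≤lex w → u ≤lex w
≤lex-trans (inj₁ p) (inj₁ q) = inj₁ (<lex-trans p q)
≤lex-trans (inj₁ p) (inj₂ refl) = inj₁ p
≤lex-trans (inj₂ refl) q = q

<lex⇒≱lex : ∀ {u v : Word k} → u <lex v → ¬ (v ≤lex u)
<lex⇒≱lex p (inj₁ q) = <lex-asym p q
<lex⇒≱lex p (inj₂ refl) = <lex-irrefl p

<lex-cancelˡ : ∀ (s : Word k) {t x} → (s ++ t) <lex (s ++ x) → t <lex x
<lex-cancelˡ [] p = p
<lex-cancelˡ (c ∷ s) (here p) = ⊥-elim (FP.<-irrefl refl p)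
<lex-cancelˡ (c ∷ s) (there p) = <lex-cancelˡ s p

<lex-congˡ : ∀ (s : Word k) {t x} → t <lex x → (s ++ t) <lex (s ++ x)
<lex-congˡ [] p = p
<lex-congˡ (c ∷ s) p = there (<lex-congˡ s p)

<lex-extension : ∀ (s : Word k) {t} → t ≢ [] → s <lex (s ++ t)
<lex-extension [] {[]} t≢[] = ⊥-elim (t≢[] refl)
<lex-extension [] {x ∷ t} _ = []<∷
<lex-extension (c ∷ s) t≢[] = there (<lex-extension s t≢[])

<lex-split : ∀ (w s : Word k) {x} → w <lex (s ++ x) → (∃ λ t → w ≡ s ++ t) ⊎ w <lex s
<lex-split w [] p = inj₁ (w , refl)
<lex-split [] (c ∷ s) p = inj₂ []<∷
<lex-split (d ∷ w) (c ∷ s) (here p) = inj₂ (here p)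
<lex-split (d ∷ w) (c ∷ s) (there p) with <lex-split w s p
... | inj₁ (t , e) = inj₁ (t , cong (d ∷_) e)
... | inj₂ q = inj₂ (there q)

<lex-truncate : ∀ (a b s : Word k) → (a ++ b) <lex s → length s ≤ length a → a <lex s
<lex-truncate [] b (y ∷ s) p ()
<lex-truncate (x ∷ a) b (y ∷ s) (here p) _ = here p
<lex-truncate (x ∷ a) b (x ∷ s) (there p) (s≤s le) = there (<lex-truncate a b s p le)

<lex-extendʳ : ∀ (a b c : Word k) → a <lex b → length b ≤ length a → a <lex (b ++ c)
<lex-extendʳ [] (y ∷ b) c []<∷ ()
<lex-extendʳ (x ∷ a) (y ∷ b) c (here p) _ = here p
<lex-extendʳ (x ∷ a) (x ∷ b) c (there p) (s≤s le) = there (<lex-extendʳ a b c p le)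

<lex-equal-length : ∀ (x t s r : Word k) → length x ≡ length t → (x ++ s) <lex (t ++ r) → x ≤lex t
<lex-equal-length [] [] s r e p = inj₂ refl
<lex-equal-length (c ∷ x) (d ∷ t) s r e (here p) = inj₁ (here p)
<lex-equal-length (c ∷ x) (c ∷ t) s r e (there p) with <lex-equal-length x t s r (suc-injective e) p
... | inj₁ q = inj₁ (there q)
... | inj₂ refl = inj₂ refl

pow : ∀ {A : Set} → List A → ℕ → List A
pow z i = concat (replicate i z)

pow-+ : ∀ {A : Set} (z : List A) i j → pow z i ++ pow z j ≡ pow z (i + j)
pow-+ z zero j = refl
pow-+ z (suc i) j = trans (LP.++-assoc z (pow z i) (pow z j)) (cong (z ++_) (pow-+ z i j))

pow-snoc : ∀ {A : Set} (z : List A) i → pow z (suc i) ≡ pow z i ++ z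
pow-snoc z i = begin
  pow z (suc i)      ≡⟨ cong (pow z) (+-comm 1 i) ⟩
  pow z (i + 1)      ≡⟨ sym (pow-+ z i 1) ⟩
  pow z i ++ z ++ [] ≡⟨ cong (pow z i ++_) (LP.++-identityʳ z) ⟩
  pow z i ++ z       ∎
  where open ≡-Reasoning

pow-[] : ∀ {A : Set} i → pow {A} [] i ≡ []
pow-[] zero = refl
pow-[] (suc i) = pow-[] i

≤-pred-by : ∀ p q f → 1 ≤ p → p + q ≤ suc f → q ≤ f
≤-pred-by p q f 1≤p le = ≤-pred (≤-trans (+-monoˡ-≤ q 1≤p) le)

-- Proof by induction on a bound f for |x| + |y|: if y = x r then x r = r x, and symmetrically.
commuting⇒powers : ∀ {A : Set} (f : ℕ) (x y : List A) → length x + length y ≤ f → x ++ y ≡ y ++ x →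
  ∃ λ z → ∃ λ i → ∃ λ j → x ≡ pow z i × y ≡ pow z j
commuting⇒powers f [] y le eq = y , 0 , 1 , refl , sym (LP.++-identityʳ y)
commuting⇒powers f (c ∷ x) [] le eq = c ∷ x , 1 , 0 , sym (LP.++-identityʳ (c ∷ x)) , refl
commuting⇒powers zero (c ∷ x) (d ∷ y) () eq
commuting⇒powers (suc f) (c ∷ x) (d ∷ y) le eq
  with ++-equidivisible (c ∷ x) (d ∷ y) (d ∷ y) (c ∷ x) eq
... | inj₁ (r , y≡xr , xr≡rx) with commuting⇒powers f (c ∷ x) r bound (trans (sym y≡xr) xr≡rx)
  where
  bound : length (c ∷ x) + length r ≤ f
  bound = subst (_≤ f) (trans (cong length y≡xr) (LP.length-++ (c ∷ x)))
            (≤-pred-by (length (c ∷ x)) (length (d ∷ y)) f (s≤s z≤n) le)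
... | z , i , j , ex , er = z , i , i + j , ex , trans y≡xr (trans (cong₂ _++_ ex er) (pow-+ z i j))
commuting⇒powers (suc f) (c ∷ x) (d ∷ y) le eq | inj₂ (r , x≡yr , yr≡ry)
  with commuting⇒powers f r (d ∷ y) bound (trans (sym yr≡ry) x≡yr)
  where
  bound : length r + length (d ∷ y) ≤ f
  bound = subst (_≤ f) (trans (cong length x≡yr) (trans (LP.length-++ (d ∷ y)) (+-comm _ (length r))))
            (≤-pred-by (length (d ∷ y)) (length (c ∷ x)) f (s≤s z≤n) (subst (_≤ suc f) (+-comm (length (c ∷ x)) _) le))
... | z , i , j , er , ey = z , j + i , j , trans x≡yr (trans (cong₂ _++_ ey er) (pow-+ z j i)) , ey

primitive⇒¬commuting : ∀ (w x y : Word k) → Primitive w → w ≡ x ++ y → x ++ y ≡ y ++ x →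
  x ≢ [] → y ≢ [] → ⊥
primitive⇒¬commuting w x y prim w≡xy comm x≢[] y≢[]
  with commuting⇒powers (length x + length y) x y ≤-refl comm
... | z , zero , j , ex , ey = x≢[] ex
... | z , suc i , zero , ex , ey = y≢[] ey
... | z , suc i , suc j , ex , ey
  with prim z (suc i + suc j) (trans w≡xy (trans (cong₂ _++_ ex ey) (pow-+ z (suc i) (suc j))))
... | e with trans (sym (+-suc i j)) (suc-injective e)
... | ()

-- Suffix characterisation: a nonempty word is Lyndon iff it is strictly smaller
-- than each of its proper nonempty suffixes.  This form is the one that
-- standard factorisation arguments use.
SuffixLyndon : Word k → Set
SuffixLyndon w = (w ≢ []) × (∀ x s → w ≡ x ++ s → x ≢ [] → s ≢ [] → w <lex s)

lyndon-rotation : ∀ {w : Word k} (u v : Word k) → Lyndon w → w ≡ u ++ v → (v ++ u) <lex w → ⊥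
lyndon-rotation u v (_ , _ , minimal) w≡uv p =
  <lex-asym p (minimal (v ++ u) (u , v , w≡uv , refl) (λ e → <lex⇒≢ p (sym e)))

-- For w = x s, the rotation s x is not below w (minimality) nor equal to it
-- (primitivity).  If w < s failed, s would be a prefix, w = s t with |t| = |x|; then
-- the rotation t s compared with w = x s gives x < t, while w < s x gives t < x.
lyndon⇒suffixLyndon : ∀ {w : Word k} → Lyndon w → SuffixLyndon w
lyndon⇒suffixLyndon {w = w} L@(w≢[] , prim , _) = w≢[] , below-suffix
  where
  below-suffix : ∀ x s → w ≡ x ++ s → x ≢ [] → s ≢ [] → w <lex s
  below-suffix x s w≡xs x≢[] s≢[] with <lex-trichotomy w (s ++ x)
  ... | inj₂ (inj₁ e) = ⊥-elim (primitive⇒¬commuting w x s prim w≡xs (trans (sym w≡xs) e) x≢[] s≢[])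
  ... | inj₂ (inj₂ p) = ⊥-elim (lyndon-rotation x s L w≡xs p)
  ... | inj₁ p with <lex-split w s p
  ... | inj₂ q = q
  ... | inj₁ (t , w≡st) = ⊥-elim border
    where
    |t|≡|x| : length t ≡ length x
    |t|≡|x| = +-cancelˡ-≡ (length s) _ _ (begin
      length s + length t ≡⟨ sym (LP.length-++ s) ⟩
      length (s ++ t)     ≡⟨ cong length (trans (sym w≡st) w≡xs) ⟩
      length (x ++ s)     ≡⟨ LP.length-++ x ⟩
      length x + length s ≡⟨ +-comm (length x) (length s) ⟩
      length s + length x ∎)
      where open ≡-Reasoning
    t≢[] : t ≢ []
    t≢[] = length≥1⇒nonempty t (subst (1 ≤_) (sym |t|≡|x|) (nonempty⇒length≥1 x x≢[]))
    border : ⊥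
    border with <lex-trichotomy w (t ++ s)
    ... | inj₂ (inj₁ e) = primitive⇒¬commuting w s t prim w≡st (trans (sym w≡st) e) s≢[] t≢[]
    ... | inj₂ (inj₂ p₂) = lyndon-rotation s t L w≡st p₂
    ... | inj₁ p₂ with <lex-equal-length x t s s (sym |t|≡|x|) (subst (_<lex (t ++ s)) w≡xs p₂)
    ... | inj₂ refl = <lex-irrefl (subst (_<lex (x ++ s)) w≡xs p₂)
    ... | inj₁ x<t = <lex-asym x<t (<lex-cancelˡ s (subst (_<lex (s ++ x)) w≡st p))

-- Conversely, a proper power z^(j+2) has the smaller suffix z^(j+1), and a
-- rotation  y x  of  w = x y  is above w already on its first |y| letters.
suffixLyndon⇒lyndon : ∀ {w : Word k} → SuffixLyndon w → Lyndon w
suffixLyndon⇒lyndon {w = w} (w≢[] , below-suffix) = w≢[] , prim , minimal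
  where
  prim : Primitive w
  prim u zero eq = ⊥-elim (w≢[] eq)
  prim u (suc zero) eq = refl
  prim [] (suc (suc j)) eq = ⊥-elim (w≢[] (trans eq (pow-[] j)))
  prim (c ∷ u) (suc (suc j)) eq = ⊥-elim (<lex-asym w<suffix suffix<w)
    where
    w<suffix : w <lex pow (c ∷ u) (suc j)
    w<suffix = below-suffix (c ∷ u) (pow (c ∷ u) (suc j)) eq (λ ()) (λ ())
    suffix<w : pow (c ∷ u) (suc j) <lex w
    suffix<w = subst (pow (c ∷ u) (suc j) <lex_) (sym (trans eq (pow-snoc (c ∷ u) (suc j))))
                 (<lex-extension (pow (c ∷ u) (suc j)) (λ ()))
  minimal : ∀ v → Conjugate w v → v ≢ w → w <lex v
  minimal v ([] , y , e₁ , e₂) v≢w = ⊥-elim (v≢w (trans e₂ (trans (LP.++-identityʳ y) (sym e₁))))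
  minimal v (x ∷ xs , [] , e₁ , e₂) v≢w = ⊥-elim (v≢w (trans e₂ (trans (sym (LP.++-identityʳ (x ∷ xs))) (sym e₁))))
  minimal v (x ∷ xs , y ∷ ys , e₁ , refl) _ =
    <lex-extendʳ w (y ∷ ys) (x ∷ xs) (below-suffix (x ∷ xs) (y ∷ ys) e₁ (λ ()) (λ ()))
      (subst (length (y ∷ ys) ≤_) (sym (cong length e₁)) (LP.length-++-≤ʳ (y ∷ ys) {x ∷ xs}))

MinimalSuffix : Word k → Word k → Set
MinimalSuffix z v = (∃ λ y → z ≡ y ++ v) × v ≢ [] × (∀ x s → z ≡ x ++ s → s ≢ [] → v ≤lex s)

-- Every nonempty word has a least nonempty suffix (compare z with the least suffix of its tail).
minimalSuffix : (z : Word k) → z ≢ [] → Σ (Word k) (MinimalSuffix z)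
minimalSuffix [] z≢[] = ⊥-elim (z≢[] refl)
minimalSuffix (c ∷ []) _ = c ∷ [] , ([] , refl) , (λ ()) , least
  where
  least : ∀ x s → c ∷ [] ≡ x ++ s → s ≢ [] → (c ∷ []) ≤lex s
  least [] s e _ = inj₂ e
  least (d ∷ []) s e s≢[] = ⊥-elim (s≢[] (sym (LP.∷-injectiveʳ e)))
  least (d ∷ e′ ∷ x) s ()
minimalSuffix (c ∷ d ∷ z) _ with minimalSuffix (d ∷ z) (λ ())
... | v , (y , e) , v≢[] , least with <lex-trichotomy (c ∷ d ∷ z) v
... | inj₂ (inj₂ v<z) = v , (c ∷ y , cong (c ∷_) e) , v≢[] , least′
  where
  least′ : ∀ x s → c ∷ d ∷ z ≡ x ++ s → s ≢ [] → v ≤lex s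
  least′ [] s e′ _ = inj₁ (subst (v <lex_) e′ v<z)
  least′ (_ ∷ x) s e′ s≢[] = least x s (LP.∷-injectiveʳ e′) s≢[]
... | inj₁ z<v = c ∷ d ∷ z , ([] , refl) , (λ ()) , least-whole (inj₁ z<v)
  where
  least-whole : (c ∷ d ∷ z) ≤lex v → ∀ x s → c ∷ d ∷ z ≡ x ++ s → s ≢ [] → (c ∷ d ∷ z) ≤lex s
  least-whole _ [] s e′ _ = inj₂ e′
  least-whole z≤v (_ ∷ x) s e′ s≢[] = ≤lex-trans z≤v (least x s (LP.∷-injectiveʳ e′) s≢[])
... | inj₂ (inj₁ z≡v) = c ∷ d ∷ z , ([] , refl) , (λ ()) , least-whole
  where
  least-whole : ∀ x s → c ∷ d ∷ z ≡ x ++ s → s ≢ [] → (c ∷ d ∷ z) ≤lex s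
  least-whole [] s e′ _ = inj₂ e′
  least-whole (_ ∷ x) s e′ s≢[] = ≤lex-trans (inj₂ z≡v) (least x s (LP.∷-injectiveʳ e′) s≢[])

-- A least nonempty suffix is Lyndon: a proper suffix of it smaller than it would
-- be a smaller suffix of the whole word.
minimalSuffix-lyndon : ∀ {z v : Word k} → MinimalSuffix z v → SuffixLyndon v
minimalSuffix-lyndon {z = z} {v} ((y , z≡yv) , v≢[] , least) = v≢[] , below-suffix
  where
  below-suffix : ∀ x s → v ≡ x ++ s → x ≢ [] → s ≢ [] → v <lex s
  below-suffix x s v≡xs x≢[] s≢[]
    with least (y ++ x) s (trans z≡yv (trans (cong (y ++_) v≡xs) (sym (LP.++-assoc y x s)))) s≢[]
  ... | inj₁ p = p
  ... | inj₂ refl = ⊥-elim (<-irrefl (cong length v≡xs) (length-<-++ x v x≢[]))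

-- With w = c y v  (v the least suffix of  y v), the prefix  u = c y  is Lyndon:
-- for u = x s, the inequality  w < s v  either is decided within s (so u < s),
-- or makes s a proper prefix  u = s r, whence  r v < v  contradicts minimality of v.
minimalSuffix-prefix-lyndon : ∀ {k} {w : Word k} c y v → SuffixLyndon w → w ≡ (c ∷ y) ++ v →
  MinimalSuffix (y ++ v) v → SuffixLyndon (c ∷ y)
minimalSuffix-prefix-lyndon {k} {w} c y v (_ , w-below) w≡uv (_ , v≢[] , least) = (λ ()) , below-suffix
  where
  u : Word k
  u = c ∷ y
  below-suffix : ∀ x s → u ≡ x ++ s → x ≢ [] → s ≢ [] → u <lex s
  below-suffix x [] _ _ s≢[] = ⊥-elim (s≢[] refl)
  below-suffix x s@(d ∷ s′) u≡xs x≢[] _ = compare (<lex-split (u ++ v) s (subst (_<lex (s ++ v)) w≡uv w<sv))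
    where
    w<sv : w <lex (s ++ v)
    w<sv = w-below x (s ++ v) (trans w≡uv (trans (cong (_++ v) u≡xs) (LP.++-assoc x s v))) x≢[] (λ ())
    |s|<|u| : length s < length u
    |s|<|u| = subst (length s <_) (cong length (sym u≡xs)) (length-<-++ x s x≢[])
    not-prefix : ∀ t → u ++ v ≡ s ++ t → ⊥
    not-prefix t uv≡st with ++-equidivisible u v s t uv≡st
    ... | inj₁ (r , s≡ur , _) =
      <-irrefl refl (<-≤-trans |s|<|u| (subst (length u ≤_) (sym (cong length s≡ur)) (LP.length-++-≤ˡ u)))
    ... | inj₂ (r , u≡sr , _) = <lex⇒≱lex rv<v (least s′ (r ++ v) y++v≡s′rv (λ e → v≢[] (LP.++-conicalʳ r v e)))
      where
      y++v≡s′rv : y ++ v ≡ s′ ++ r ++ v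
      y++v≡s′rv = trans (cong (_++ v) (LP.∷-injectiveʳ u≡sr)) (LP.++-assoc s′ r v)
      rv<v : (r ++ v) <lex v
      rv<v = <lex-cancelˡ s (subst (_<lex (s ++ v)) (trans w≡uv (trans (cong (_++ v) u≡sr) (LP.++-assoc s r v))) w<sv)
    compare : (∃ λ t → u ++ v ≡ s ++ t) ⊎ (u ++ v) <lex s → u <lex s
    compare (inj₁ (t , uv≡st)) = ⊥-elim (not-prefix t uv≡st)
    compare (inj₂ uv<s) = <lex-truncate u v s uv<s (<⇒≤ |s|<|u|)

lyndon-factorisation : ∀ {w : Word k} → Lyndon w → 2 ≤ length w →
  ∃ λ u → ∃ λ v → w ≡ u ++ v × Lyndon u × Lyndon v
lyndon-factorisation {w = []} _ ()
lyndon-factorisation {w = c ∷ []} _ (s≤s ())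
lyndon-factorisation {w = c ∷ w′@(_ ∷ _)} L _ with minimalSuffix w′ (λ ())
... | v , (y , w′≡yv) , min =
  c ∷ y , v , w≡uv ,
  suffixLyndon⇒lyndon (minimalSuffix-prefix-lyndon c y v (lyndon⇒suffixLyndon L) w≡uv
                        (subst (λ z → MinimalSuffix z v) w′≡yv ((y , w′≡yv) , min))) ,
  suffixLyndon⇒lyndon (minimalSuffix-lyndon ((y , w′≡yv) , min))
  where
  w≡uv : c ∷ w′ ≡ (c ∷ y) ++ v
  w≡uv = cong (c ∷_) w′≡yv

factor-length : ∀ {y w : Word k} → Factor y w → length y ≤ length w
factor-length {y = y} (x , z , refl) = ≤-trans (LP.length-++-≤ˡ y) (LP.length-++-≤ʳ (y ++ z) {x})

factor-trans : ∀ {a b c : Word k} → Factor a b → Factor b c → Factor a c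
factor-trans {a = a} (x , y , refl) (x′ , y′ , refl) = x′ ++ x , y ++ y′ , eq
  where
  open ≡-Reasoning
  eq : x′ ++ (x ++ a ++ y) ++ y′ ≡ (x′ ++ x) ++ a ++ (y ++ y′)
  eq = begin
    x′ ++ (x ++ a ++ y) ++ y′   ≡⟨ cong (x′ ++_) (LP.++-assoc x (a ++ y) y′) ⟩
    x′ ++ x ++ (a ++ y) ++ y′   ≡⟨ cong (λ t → x′ ++ x ++ t) (LP.++-assoc a y y′) ⟩
    x′ ++ x ++ a ++ y ++ y′     ≡⟨ sym (LP.++-assoc x′ x (a ++ y ++ y′)) ⟩
    (x′ ++ x) ++ a ++ y ++ y′   ∎

factor-left : ∀ (u v : Word k) → Factor u (u ++ v)
factor-left u v = [] , v , refl

factor-right : ∀ (u v : Word k) → Factor v (u ++ v)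
factor-right u v = u , [] , cong (u ++_) (sym (LP.++-identityʳ v))

factor-refl : ∀ (u : Word k) → Factor u u
factor-refl u = [] , [] , sym (LP.++-identityʳ u)

factor-equal-length : ∀ {y w : Word k} → Factor y w → length y ≡ length w → y ≡ w
factor-equal-length {y = y} ([] , [] , e) _ = sym (trans e (LP.++-identityʳ y))
factor-equal-length {y = y} ([] , c ∷ z , refl) |y|≡|w| =
  ⊥-elim (<-irrefl |y|≡|w| (subst (length y <_) (LP.length-++-comm (c ∷ z) y) (length-<-++ (c ∷ z) y (λ ()))))
factor-equal-length (c ∷ x , z , refl) |y|≡|w| = ⊥-elim (<-irrefl |y|≡|w| (s≤s (factor-length (x , z , refl))))

prefix? : (u w : Word k) → Dec (∃ λ t → w ≡ u ++ t)
prefix? [] w = yes (w , refl)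
prefix? (c ∷ u) [] = no (λ { (t , ()) })
prefix? (c ∷ u) (d ∷ w) with c ≟F d
... | no c≢d = no (λ { (t , e) → c≢d (sym (LP.∷-injectiveˡ e)) })
... | yes refl with prefix? u w
... | yes (t , e) = yes (t , cong (c ∷_) e)
... | no ¬pre = no (λ { (t , e) → ¬pre (t , LP.∷-injectiveʳ e) })

factor? : (u w : Word k) → Dec (Factor u w)
factor? u w with prefix? u w
... | yes (t , e) = yes ([] , t , e)
factor? u [] | no ¬pre = no (λ { ([] , y , e) → ¬pre (y , e) ; (c ∷ x , y , ()) })
factor? u (d ∷ w) | no ¬pre with factor? u w
... | yes (x , y , e) = yes (d ∷ x , y , cong (d ∷_) e)
... | no ¬fac = no (λ { ([] , y , e) → ¬pre (y , e) ; (c ∷ x , y , e) → ¬fac (x , y , LP.∷-injectiveʳ e) })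

-- Families of distinct Lyndon factors.  LyndonFactors w n  witnesses  𝓛(w) ≥ n
-- by an explicit duplicate-free list of n Lyndon factors of w.

LyndonFactor : Word k → Word k → Set
LyndonFactor w y = Lyndon y × Factor y w

LyndonFactors : Word k → ℕ → Set
LyndonFactors {k} w n = Σ (List (Word k)) λ ls → Unique ls × length ls ≡ n × All (LyndonFactor w) ls

lyndonFactor-lift : ∀ {c w : Word k} → Factor c w → ∀ {ls} → All (LyndonFactor c) ls → All (LyndonFactor w) ls
lyndonFactor-lift c⊑w = All.map (λ { (Ly , y⊑c) → Ly , factor-trans y⊑c c⊑w })

longer-fresh : ∀ {c w : Word k} {ls} → length c < length w → All (LyndonFactor c) ls → All (w ≢_) ls
longer-fresh lt = All.map (λ { (_ , y⊑c) refl → <-irrefl refl (<-≤-trans lt (factor-length y⊑c)) })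

nonfactor-fresh : ∀ {c z : Word k} {ls} → ¬ Factor z c → All (LyndonFactor c) ls → All (z ≢_) ls
nonfactor-fresh z⋢c = All.map (λ { (_ , y⊑c) refl → z⋢c y⊑c })

extend-by-word : ∀ {c w : Word k} {n} → LyndonFactors c n → Factor c w → length c < length w → Lyndon w →
  LyndonFactors w (suc n)
extend-by-word {w = w} (ls , uniq , len , all) c⊑w lt Lw =
  w ∷ ls , longer-fresh lt all ∷ uniq , cong suc len , (Lw , factor-refl w) ∷ lyndonFactor-lift c⊑w all

extend-by-two : ∀ {c w z : Word k} {n} → LyndonFactors c n → Factor c w → length c < length w →
  Lyndon z → Factor z w → ¬ Factor z c → length z < length w → Lyndon w → LyndonFactors w (suc (suc n))
extend-by-two {w = w} {z} (ls , uniq , len , all) c⊑w lt Lz z⊑w z⋢c z<w Lw =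
  w ∷ z ∷ ls ,
  ((λ { refl → <-irrefl refl z<w }) ∷ longer-fresh lt all) ∷ nonfactor-fresh z⋢c all ∷ uniq ,
  cong (λ t → suc (suc t)) len ,
  (Lw , factor-refl w) ∷ (Lz , z⊑w) ∷ lyndonFactor-lift c⊑w all

unique-length-≤ : ∀ {A : Set} (xs ys : List A) → Unique xs → All (_∈ ys) xs → length xs ≤ length ys
unique-length-≤ [] ys _ _ = z≤n
unique-length-≤ (x ∷ xs) ys (x∉xs ∷ uniq) (x∈ys ∷ xs⊆ys) with ∈-∃++ x∈ys
... | ys₁ , ys₂ , refl =
  subst (suc (length xs) ≤_) (sym (trans (LP.length-++ ys₁) (+-suc (length ys₁) (length ys₂))))
    (s≤s (subst (length xs ≤_) (LP.length-++ ys₁)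
      (unique-length-≤ xs (ys₁ ++ ys₂) uniq (remove xs x∉xs xs⊆ys))))
  where
  remove : ∀ zs → All (x ≢_) zs → All (_∈ (ys₁ ++ x ∷ ys₂)) zs → All (_∈ (ys₁ ++ ys₂)) zs
  remove [] [] [] = []
  remove (y ∷ zs) (x≢y ∷ fresh) (y∈ ∷ ⊆) = y∈′ ∷ remove zs fresh ⊆
    where
    y∈′ : y ∈ (ys₁ ++ ys₂)
    y∈′ with ∈-++⁻ ys₁ y∈
    ... | inj₁ m = ∈-++⁺ˡ m
    ... | inj₂ (here y≡x) = ⊥-elim (x≢y (sym y≡x))
    ... | inj₂ (there m) = ∈-++⁺ʳ ys₁ m

fib-pos : ∀ n → 1 ≤ fib (suc n)
fib-pos zero = s≤s z≤n
fib-pos (suc n) = ≤-trans (fib-pos n) (m≤m+n _ _)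

fib-< : ∀ m → fib (suc (suc m)) < fib (suc (suc (suc m)))
fib-< m = subst (_≤ fib (suc (suc m)) + fib (suc m)) (+-comm (fib (suc (suc m))) 1)
  (+-monoʳ-≤ (fib (suc (suc m))) (fib-pos m))

lyndon-length≥1 : ∀ {u : Word k} → Lyndon u → 1 ≤ length u
lyndon-length≥1 {u = u} L = nonempty⇒length≥1 u (proj₁ L)

length-<-left : ∀ (u v : Word k) → Lyndon v → length u < length (u ++ v)
length-<-left u v Lv = subst (length u <_) (LP.length-++-comm v u) (length-<-++ v u (proj₁ Lv))

length-<-right : ∀ (u v : Word k) → Lyndon u → length v < length (u ++ v)
length-<-right u v Lu = length-<-++ u v (proj₁ Lu)

-- Standard factors u, v that are different (as in a primitive word) each carrying
-- n Lyndon factors: one of them is not a factor of the other, which adds two words.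
extend-by-both : ∀ {u v : Word k} {n} → LyndonFactors u n → LyndonFactors v n →
  Lyndon u → Lyndon v → Lyndon (u ++ v) → LyndonFactors (u ++ v) (suc (suc n))
extend-by-both {u = u} {v} Fu Fv Lu Lv L with factor? u v
... | no u⋢v = extend-by-two Fv (factor-right u v) (length-<-right u v Lu)
                 Lu (factor-left u v) u⋢v (length-<-left u v Lv) L
... | yes u⊑v with factor? v u
... | no v⋢u = extend-by-two Fu (factor-left u v) (length-<-left u v Lv)
                 Lv (factor-right u v) v⋢u (length-<-right u v Lu) L
... | yes v⊑u = ⊥-elim (primitive⇒¬commuting (u ++ v) u v (proj₁ (proj₂ L)) refl uv≡vu (proj₁ Lu) (proj₁ Lv))
  where
  uv≡vu : u ++ v ≡ v ++ u
  uv≡vu rewrite factor-equal-length u⊑v (≤-antisym (factor-length u⊑v) (factor-length v⊑u)) = refl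

<-from-sum : ∀ A B U V → A + B < U + V → V ≤ A → B < U
<-from-sum A B U V lt V≤A =
  +-cancelˡ-< A B U (<-≤-trans lt (≤-trans (+-monoʳ-≤ U V≤A) (≤-reflexive (+-comm U A))))

-- Induction on n along the standard factorisation w = uv: if one factor is longer
-- than F_(n-1) it carries n factors by induction and w adds one; otherwise both
-- are longer than F_(n-2) and extend-by-both applies.
lyndonFactors-lower : ∀ n (w : Word k) → Lyndon w → fib n < length w → LyndonFactors w (suc n)
lyndonFactors-lower zero w L _ = w ∷ [] , [] ∷ [] , refl , (L , factor-refl w) ∷ []
lyndonFactors-lower (suc n) w L F<|w| with lyndon-factorisation L (≤-trans (s≤s (fib-pos n)) F<|w|)
... | u , v , refl , Lu , Lv with fib n <? length u | fib n <? length v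
... | yes F<|u| | _ =
  extend-by-word (lyndonFactors-lower n u Lu F<|u|) (factor-left u v) (length-<-left u v Lv) L
... | no _ | yes F<|v| =
  extend-by-word (lyndonFactors-lower n v Lv F<|v|) (factor-right u v) (length-<-right u v Lu) L
... | no |u|≯F | no |v|≯F = balanced n F<|w| (≮⇒≥ |u|≯F) (≮⇒≥ |v|≯F)
  where
  balanced : ∀ n → fib (suc n) < length (u ++ v) → length u ≤ fib n → length v ≤ fib n →
    LyndonFactors (u ++ v) (suc (suc n))
  balanced zero _ |u|≤0 _ = ⊥-elim (<-irrefl refl (≤-trans (lyndon-length≥1 Lu) |u|≤0))
  balanced (suc m) F<|uv| |u|≤F |v|≤F =
    extend-by-both (lyndonFactors-lower m u Lu F<|u|) (lyndonFactors-lower m v Lv F<|v|) Lu Lv L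
    where
    F<|u|+|v| : fib (suc m) + fib m < length u + length v
    F<|u|+|v| = subst (fib (suc m) + fib m <_) (LP.length-++ u) F<|uv|
    F<|u| : fib m < length u
    F<|u| = <-from-sum (fib (suc m)) (fib m) (length u) (length v) F<|u|+|v| |v|≤F
    F<|v| : fib m < length v
    F<|v| = <-from-sum (fib (suc m)) (fib m) (length v) (length u)
              (subst (fib (suc m) + fib m <_) (+-comm (length u) (length v)) F<|u|+|v|) |u|≤F

-- Avoiding a two-letter pattern: w has no factor  x y.  Used to separate the
-- two families of Fibonacci Lyndon words (one avoids bb, the other aa).

Avoids : Fin k → Fin k → Word k → Set
Avoids x y [] = ⊤
Avoids x y (c ∷ []) = ⊤
Avoids x y (c ∷ d ∷ r) = ¬ (c ≡ x × d ≡ y) × Avoids x y (d ∷ r)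

avoids-++ : ∀ {x y : Fin k} (l : Word k) h r → Avoids x y l → Avoids x y (h ∷ r) →
  (∀ l′ → l ≡ l′ ++ x ∷ [] → h ≢ y) → Avoids x y (l ++ h ∷ r)
avoids-++ [] h r _ avr _ = avr
avoids-++ (c ∷ []) h r _ avr junction = (λ { (refl , refl) → junction [] refl refl }) , avr
avoids-++ (c ∷ d ∷ l) h r (¬xy , avl) avr junction =
  ¬xy , avoids-++ (d ∷ l) h r avl avr (λ l′ e → junction (c ∷ l′) (cong (c ∷_) e))

avoids-prefix : ∀ {x y : Fin k} (l r : Word k) → Avoids x y (l ++ r) → Avoids x y l
avoids-prefix [] r _ = tt
avoids-prefix (c ∷ []) r _ = tt
avoids-prefix (c ∷ d ∷ l) r (¬xy , av) = ¬xy , avoids-prefix (d ∷ l) r av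

avoids⇒¬factor : ∀ {x y : Fin k} (w : Word k) → Avoids x y w → ¬ Factor (x ∷ y ∷ []) w
avoids⇒¬factor _ (¬xy , _) ([] , z , refl) = ¬xy (refl , refl)
avoids⇒¬factor (c ∷ []) _ (d ∷ [] , z , ())
avoids⇒¬factor (c ∷ []) _ (d ∷ e ∷ l , z , ())
avoids⇒¬factor (c ∷ d ∷ w) (_ , av) (e ∷ l , z , eq) = avoids⇒¬factor (d ∷ w) av (l , z , LP.∷-injectiveʳ eq)

avoids-map : ∀ {x y x′ y′ : Fin k} (g : Fin k → Fin k) →
  (∀ c → g c ≡ x′ → c ≡ x) → (∀ c → g c ≡ y′ → c ≡ y) →
  (l : Word k) → Avoids x y l → Avoids x′ y′ (map g l)
avoids-map g gx gy [] _ = tt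
avoids-map g gx gy (c ∷ []) _ = tt
avoids-map g gx gy (c ∷ d ∷ l) (¬xy , av) =
  (λ { (e₁ , e₂) → ¬xy (gx c e₁ , gy d e₂) }) , avoids-map g gx gy (d ∷ l) av

module FibonacciWords {k : ℕ} (a b : Fin k) (a<b : a <F b) where

  f : ℕ → Word k
  f = fibWord a b

  p : ℕ → Word k
  p = pWord a b

  swap : Fin k → Fin k
  swap = swapLetter a b

  c : Word k → Word k
  c = cMorph a b

  X : ℕ → Word k
  X n = a ∷ (p n ++ b ∷ [])

  Y : ℕ → Word k
  Y n = a ∷ (c (p n) ++ b ∷ [])

  IsFibLyndon : ℕ → Word k → Set
  IsFibLyndon n w = w ≡ X n ⊎ w ≡ Y n

  a≢b : a ≢ b
  a≢b e = FP.<-irrefl e a<b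

  swap-a : swap a ≡ b
  swap-a with a ≟F a
  ... | yes _ = refl
  ... | no a≢a = ⊥-elim (a≢a refl)

  swap-b : swap b ≡ a
  swap-b with b ≟F a
  ... | yes b≡a = ⊥-elim (a≢b (sym b≡a))
  ... | no _ with b ≟F b
  ... | yes _ = refl
  ... | no b≢b = ⊥-elim (b≢b refl)

  swap⁻¹-a : ∀ x → swap x ≡ a → x ≡ b
  swap⁻¹-a x e with x ≟F a
  ... | yes refl = ⊥-elim (a≢b (sym e))
  ... | no x≢a with x ≟F b
  ... | yes refl = refl
  ... | no _ = ⊥-elim (x≢a e)

  swap⁻¹-b : ∀ x → swap x ≡ b → x ≡ a
  swap⁻¹-b x e with x ≟F a
  ... | yes refl = refl
  ... | no _ with x ≟F b
  ... | yes refl = ⊥-elim (a≢b e)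
  ... | no x≢b = ⊥-elim (x≢b e)

  OverAB : Fin k → Set
  OverAB x = x ≡ a ⊎ x ≡ b

  swap-overAB : ∀ {x} → OverAB x → OverAB (swap x)
  swap-overAB (inj₁ refl) = inj₂ swap-a
  swap-overAB (inj₂ refl) = inj₁ swap-b

  f-overAB : ∀ n → All OverAB (f n)
  f-overAB zero = []
  f-overAB (suc zero) = inj₂ refl ∷ []
  f-overAB (suc (suc zero)) = inj₁ refl ∷ []
  f-overAB (suc (suc (suc n))) = AllP.++⁺ (f-overAB (suc (suc n))) (f-overAB (suc n))

  p-overAB : ∀ n → All OverAB (p n)
  p-overAB n = AllP.take⁺ _ (f-overAB n)

  X-overAB : ∀ n → All OverAB (X n)
  X-overAB n = inj₁ refl ∷ AllP.++⁺ (p-overAB n) (inj₂ refl ∷ [])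

  Y-overAB : ∀ n → All OverAB (Y n)
  Y-overAB n = inj₁ refl ∷ AllP.++⁺ (AllP.map⁺ (All.map swap-overAB (p-overAB n))) (inj₂ refl ∷ [])

  -- The last two letters  d n  of f_n alternate between  ba  (n even) and  ab  (n odd).
  d : ℕ → Word k
  d zero = b ∷ a ∷ []
  d (suc zero) = a ∷ b ∷ []
  d (suc (suc n)) = d n

  d-shape : ∀ n → ∃ λ x → ∃ λ y → d n ≡ x ∷ y ∷ []
  d-shape zero = b , a , refl
  d-shape (suc zero) = a , b , refl
  d-shape (suc (suc n)) = d-shape n

  Flip : Fin k → Fin k → Set
  Flip x y = (x ≡ b × y ≡ a) ⊎ (x ≡ a × y ≡ b)

  flip-sym : ∀ {x y} → Flip x y → Flip y x
  flip-sym (inj₁ (refl , refl)) = inj₂ (refl , refl)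
  flip-sym (inj₂ (refl , refl)) = inj₁ (refl , refl)

  flip-swap : ∀ {x y} → Flip x y → Flip (swap x) (swap y)
  flip-swap (inj₁ (refl , refl)) = inj₂ (swap-b , swap-a)
  flip-swap (inj₂ (refl , refl)) = inj₁ (swap-a , swap-b)

  d-alternates : ∀ m → ∃ λ x → ∃ λ y → Flip x y × d (4 + m) ≡ x ∷ y ∷ [] × d (5 + m) ≡ y ∷ x ∷ []
  d-alternates m = go m
    where
    go : ∀ m → ∃ λ x → ∃ λ y → Flip x y × d m ≡ x ∷ y ∷ [] × d (suc m) ≡ y ∷ x ∷ []
    go zero = b , a , inj₁ (refl , refl) , refl , refl
    go (suc zero) = a , b , inj₂ (refl , refl) , refl , refl
    go (suc (suc m)) = go m

  f-starts-with-a : ∀ m → ∃ λ r → f (2 + m) ≡ a ∷ r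
  f-starts-with-a zero = [] , refl
  f-starts-with-a (suc m) with f-starts-with-a m
  ... | r , e = r ++ f (suc m) , cong (_++ f (suc m)) e

  f-ends-with-d : ∀ m → ∃ λ q → f (3 + m) ≡ q ++ d (3 + m)
  f-ends-with-d zero = [] , refl
  f-ends-with-d (suc zero) = a ∷ [] , refl
  f-ends-with-d (suc (suc m)) with f-ends-with-d m
  ... | q , e = f (4 + m) ++ q , trans (cong (f (4 + m) ++_) e) (sym (LP.++-assoc (f (4 + m)) q (d (3 + m))))

  take-length-++ : ∀ (q r : Word k) → take (length q) (q ++ r) ≡ q
  take-length-++ [] r = refl
  take-length-++ (x ∷ q) r = cong (x ∷_) (take-length-++ q r)

  take-drop-last-two : ∀ (q : Word k) x y → take (length (q ++ x ∷ y ∷ []) ∸ 2) (q ++ x ∷ y ∷ []) ≡ q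
  take-drop-last-two q x y rewrite LP.length-++ q {x ∷ y ∷ []} | +-comm (length q) 2 = take-length-++ q (x ∷ y ∷ [])

  f≡p++d : ∀ m → f (3 + m) ≡ p (3 + m) ++ d (3 + m)
  f≡p++d m with f-ends-with-d m | d-shape (3 + m)
  ... | q , e | x , y , d≡xy = trans e (cong (_++ d (3 + m)) (sym p≡q))
    where
    p≡q : p (3 + m) ≡ q
    p≡q = trans (cong (λ t → take (length t ∸ 2) t) e)
            (subst (λ t → take (length (q ++ t) ∸ 2) (q ++ t) ≡ q) (sym d≡xy) (take-drop-last-two q x y))

  p-recurrence : ∀ m → p (5 + m) ≡ p (4 + m) ++ d (4 + m) ++ p (3 + m)
  p-recurrence m = LP.++-cancelʳ (d (3 + m)) (p (5 + m)) (p (4 + m) ++ d (4 + m) ++ p (3 + m)) (begin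
    p (5 + m) ++ d (3 + m)
      ≡⟨ sym (f≡p++d (2 + m)) ⟩
    f (4 + m) ++ f (3 + m)
      ≡⟨ cong₂ _++_ (f≡p++d (1 + m)) (f≡p++d m) ⟩
    (p (4 + m) ++ d (4 + m)) ++ p (3 + m) ++ d (3 + m)
      ≡⟨ LP.++-assoc (p (4 + m)) (d (4 + m)) _ ⟩
    p (4 + m) ++ d (4 + m) ++ p (3 + m) ++ d (3 + m)
      ≡⟨ cong (p (4 + m) ++_) (sym (LP.++-assoc (d (4 + m)) (p (3 + m)) (d (3 + m)))) ⟩
    p (4 + m) ++ (d (4 + m) ++ p (3 + m)) ++ d (3 + m)
      ≡⟨ sym (LP.++-assoc (p (4 + m)) (d (4 + m) ++ p (3 + m)) (d (3 + m))) ⟩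
    (p (4 + m) ++ d (4 + m) ++ p (3 + m)) ++ d (3 + m)
      ∎)
    where open ≡-Reasoning

  p-recurrence′ : ∀ m → p (5 + m) ≡ p (3 + m) ++ d (5 + m) ++ p (4 + m)
  p-recurrence′ zero = refl
  p-recurrence′ (suc m) = begin
    p (6 + m)
      ≡⟨ p-recurrence (suc m) ⟩
    p (5 + m) ++ d (5 + m) ++ p (4 + m)
      ≡⟨ cong (_++ d (5 + m) ++ p (4 + m)) (p-recurrence m) ⟩
    (p (4 + m) ++ d (4 + m) ++ p (3 + m)) ++ d (5 + m) ++ p (4 + m)
      ≡⟨ LP.++-assoc (p (4 + m)) _ _ ⟩
    p (4 + m) ++ (d (4 + m) ++ p (3 + m)) ++ d (5 + m) ++ p (4 + m)
      ≡⟨ cong (p (4 + m) ++_) (LP.++-assoc (d (4 + m)) _ _) ⟩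
    p (4 + m) ++ d (4 + m) ++ p (3 + m) ++ d (5 + m) ++ p (4 + m)
      ≡⟨ cong (λ t → p (4 + m) ++ d (4 + m) ++ t) (sym (p-recurrence′ m)) ⟩
    p (4 + m) ++ d (6 + m) ++ p (5 + m)
      ∎
    where open ≡-Reasoning

  p-split : ∀ m → ∃ λ x → ∃ λ y → Flip x y ×
    p (5 + m) ≡ p (4 + m) ++ x ∷ y ∷ p (3 + m) × p (5 + m) ≡ p (3 + m) ++ y ∷ x ∷ p (4 + m)
  p-split m with d-alternates m
  ... | x , y , xy , d₄ , d₅ =
    x , y , xy ,
    subst (λ t → p (5 + m) ≡ p (4 + m) ++ t ++ p (3 + m)) d₄ (p-recurrence m) ,
    subst (λ t → p (5 + m) ≡ p (3 + m) ++ t ++ p (4 + m)) d₅ (p-recurrence′ m)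

  p-starts-with-a : ∀ m → ∃ λ r → p (4 + m) ≡ a ∷ r
  p-starts-with-a zero = [] , refl
  p-starts-with-a (suc m) with p-starts-with-a m
  ... | r , e = r ++ d (4 + m) ++ p (3 + m) , trans (p-recurrence m) (cong (_++ d (4 + m) ++ p (3 + m)) e)

  p-ends-with-a : ∀ m → ∃ λ r → p (4 + m) ≡ r ++ a ∷ []
  p-ends-with-a zero = [] , refl
  p-ends-with-a (suc m) with p-ends-with-a m
  ... | r , e = p (3 + m) ++ d (5 + m) ++ r , (begin
    p (5 + m)                                 ≡⟨ p-recurrence′ m ⟩
    p (3 + m) ++ d (5 + m) ++ p (4 + m)       ≡⟨ cong (λ t → p (3 + m) ++ d (5 + m) ++ t) e ⟩
    p (3 + m) ++ d (5 + m) ++ r ++ a ∷ []     ≡⟨ cong (p (3 + m) ++_) (sym (LP.++-assoc (d (5 + m)) r (a ∷ []))) ⟩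
    p (3 + m) ++ (d (5 + m) ++ r) ++ a ∷ []   ≡⟨ sym (LP.++-assoc (p (3 + m)) (d (5 + m) ++ r) (a ∷ [])) ⟩
    (p (3 + m) ++ d (5 + m) ++ r) ++ a ∷ []   ∎)
    where open ≡-Reasoning

  -- The X-family avoids bb (f_n has no bb, and X n = a p_n b joins p_n only to a's);
  -- the Y-family avoids aa, while containing bb from length F_4 on (and X contains aa).
  f-avoids-bb : ∀ n → Avoids b b (f n)
  f-avoids-bb zero = tt
  f-avoids-bb (suc zero) = tt
  f-avoids-bb (suc (suc zero)) = tt
  f-avoids-bb (suc (suc (suc zero))) = (λ { (a≡b , _) → a≢b a≡b }) , tt
  f-avoids-bb (suc (suc (suc (suc m)))) = subst (λ t → Avoids b b (f (3 + m) ++ t)) (sym e)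
    (avoids-++ (f (3 + m)) a r (f-avoids-bb (suc (suc (suc m)))) (subst (Avoids b b) e (f-avoids-bb (suc (suc m)))) (λ _ _ → a≢b))
    where
    r : Word k
    r = proj₁ (f-starts-with-a m)
    e : f (2 + m) ≡ a ∷ r
    e = proj₂ (f-starts-with-a m)

  p-avoids-bb : ∀ m → Avoids b b (p (3 + m))
  p-avoids-bb m = avoids-prefix (p (3 + m)) (d (3 + m)) (subst (Avoids b b) (f≡p++d m) (f-avoids-bb (3 + m)))

  X-avoids-bb : ∀ m → Avoids b b (X (4 + m))
  X-avoids-bb m with p-starts-with-a m | p-ends-with-a m
  ... | r , e | r′ , e′ = avoids-++ (a ∷ p (4 + m)) b [] a-p-avoids tt junction
    where
    a-p-avoids : Avoids b b (a ∷ p (4 + m))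
    a-p-avoids = subst (λ z → Avoids b b (a ∷ z)) (sym e)
                   ((λ { (a≡b , _) → a≢b a≡b }) , subst (Avoids b b) e (p-avoids-bb (suc m)))
    junction : ∀ l′ → a ∷ p (4 + m) ≡ l′ ++ b ∷ [] → b ≢ b
    junction l′ e₂ _ = a≢b (LP.∷ʳ-injectiveʳ (a ∷ r′) l′ (trans (cong (a ∷_) (sym e′)) e₂))

  Y-avoids-aa : ∀ m → Avoids a a (Y (4 + m))
  Y-avoids-aa m with p-starts-with-a m
  ... | r , e = avoids-++ (a ∷ c (p (4 + m))) b [] a-cp-avoids tt (λ _ _ b≡a → a≢b (sym b≡a))
    where
    cp-avoids : Avoids a a (c (p (4 + m)))
    cp-avoids = avoids-map swap swap⁻¹-a swap⁻¹-a (p (4 + m)) (p-avoids-bb (suc m))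
    a-cp-avoids : Avoids a a (a ∷ c (p (4 + m)))
    a-cp-avoids = subst (λ z → Avoids a a (a ∷ c z)) (sym e)
      (avoids-++ (a ∷ []) (swap a) (c r) tt (subst (λ z → Avoids a a (c z)) e cp-avoids)
        (λ _ _ sa≡a → a≢b (sym (trans (sym swap-a) sa≡a))))

  bb-factor-Y : ∀ m → Factor (b ∷ b ∷ []) (Y (4 + m))
  bb-factor-Y m with p-ends-with-a m
  ... | r′ , e′ = a ∷ c r′ , [] , cong (a ∷_) (begin
    c (p (4 + m)) ++ b ∷ []               ≡⟨ cong (λ t → c t ++ b ∷ []) e′ ⟩
    c (r′ ++ a ∷ []) ++ b ∷ []            ≡⟨ cong (_++ b ∷ []) (LP.map-++ swap r′ (a ∷ [])) ⟩
    (c r′ ++ swap a ∷ []) ++ b ∷ []       ≡⟨ cong (λ t → (c r′ ++ t ∷ []) ++ b ∷ []) swap-a ⟩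
    (c r′ ++ b ∷ []) ++ b ∷ []            ≡⟨ LP.++-assoc (c r′) (b ∷ []) (b ∷ []) ⟩
    c r′ ++ (b ∷ b ∷ []) ++ []            ∎)
    where open ≡-Reasoning

  aa-factor-X : ∀ m → Factor (a ∷ a ∷ []) (X (4 + m))
  aa-factor-X m with p-starts-with-a m
  ... | r , e = [] , r ++ b ∷ [] , cong (λ t → a ∷ (t ++ b ∷ [])) e

  -- A shorter Fibonacci Lyndon word inside a longer one belongs to the same family
  -- (X_3 = Y_3 = ab; beyond that, bb resp. aa would have to occur in the longer word).
  same-family : ∀ m {l s} → IsFibLyndon (4 + m) l → IsFibLyndon (3 + m) s → Factor s l →
    (l ≡ X (4 + m) × s ≡ X (3 + m)) ⊎ (l ≡ Y (4 + m) × s ≡ Y (3 + m))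
  same-family m (inj₁ l≡X) (inj₁ s≡X) _ = inj₁ (l≡X , s≡X)
  same-family m (inj₂ l≡Y) (inj₂ s≡Y) _ = inj₂ (l≡Y , s≡Y)
  same-family zero (inj₁ l≡X) (inj₂ s≡Y) _ = inj₁ (l≡X , s≡Y)
  same-family zero (inj₂ l≡Y) (inj₁ s≡X) _ = inj₂ (l≡Y , s≡X)
  same-family (suc m) (inj₁ refl) (inj₂ refl) s⊑l =
    ⊥-elim (avoids⇒¬factor (X (5 + m)) (X-avoids-bb (suc m)) (factor-trans (bb-factor-Y m) s⊑l))
  same-family (suc m) (inj₂ refl) (inj₁ refl) s⊑l =
    ⊥-elim (avoids⇒¬factor (Y (5 + m)) (Y-avoids-aa (suc m)) (factor-trans (aa-factor-X m) s⊑l))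

  X-concat : ∀ (A B : Word k) → (a ∷ (A ++ b ∷ [])) ++ (a ∷ (B ++ b ∷ [])) ≡ a ∷ ((A ++ b ∷ a ∷ B) ++ b ∷ [])
  X-concat A B = cong (a ∷_)
    (trans (LP.++-assoc A (b ∷ []) (a ∷ B ++ b ∷ [])) (sym (LP.++-assoc A (b ∷ a ∷ B) (b ∷ []))))

  -- For xy = ba this is X-concat; for xy = ab the
  -- rotation (aBb)(aAb) = a A a b B b would be smaller than a A b a B b.
  concat-lyndon : ∀ (A B Q : Word k) x y → Flip x y → Q ≡ A ++ x ∷ y ∷ B → Q ≡ B ++ y ∷ x ∷ A →
    Lyndon ((a ∷ (A ++ b ∷ [])) ++ (a ∷ (B ++ b ∷ []))) →
    (a ∷ (A ++ b ∷ [])) ++ (a ∷ (B ++ b ∷ [])) ≡ a ∷ (Q ++ b ∷ [])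
  concat-lyndon A B Q x y (inj₁ (refl , refl)) Q≡AbaB _ _ =
    trans (X-concat A B) (cong (λ t → a ∷ (t ++ b ∷ [])) (sym Q≡AbaB))
  concat-lyndon A B Q x y (inj₂ (refl , refl)) Q≡AabB Q≡BbaA L =
    ⊥-elim (lyndon-rotation (a ∷ (A ++ b ∷ [])) (a ∷ (B ++ b ∷ [])) L refl (subst₂ _<lex_ (sym vu) (sym uv) vu<uv))
    where
    vu : (a ∷ (B ++ b ∷ [])) ++ (a ∷ (A ++ b ∷ [])) ≡ a ∷ (A ++ a ∷ (b ∷ B ++ b ∷ []))
    vu = trans (X-concat B A) (cong (a ∷_)
           (trans (cong (_++ b ∷ []) (trans (sym Q≡BbaA) Q≡AabB)) (LP.++-assoc A (a ∷ b ∷ B) (b ∷ []))))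
    uv : (a ∷ (A ++ b ∷ [])) ++ (a ∷ (B ++ b ∷ [])) ≡ a ∷ (A ++ b ∷ (a ∷ B ++ b ∷ []))
    uv = trans (X-concat A B) (cong (a ∷_) (LP.++-assoc A (b ∷ a ∷ B) (b ∷ [])))
    vu<uv : (a ∷ (A ++ a ∷ (b ∷ B ++ b ∷ []))) <lex (a ∷ (A ++ b ∷ (a ∷ B ++ b ∷ [])))
    vu<uv = there (<lex-congˡ A (here a<b))

  concat-lyndon-c : ∀ (A B Q : Word k) x y → Flip x y → Q ≡ A ++ x ∷ y ∷ B → Q ≡ B ++ y ∷ x ∷ A →
    Lyndon ((a ∷ (c A ++ b ∷ [])) ++ (a ∷ (c B ++ b ∷ []))) →
    (a ∷ (c A ++ b ∷ [])) ++ (a ∷ (c B ++ b ∷ [])) ≡ a ∷ (c Q ++ b ∷ [])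
  concat-lyndon-c A B Q x y xy Q≡AxyB Q≡ByxA =
    concat-lyndon (c A) (c B) (c Q) (swap x) (swap y) (flip-swap xy)
      (trans (cong c Q≡AxyB) (LP.map-++ swap A (x ∷ y ∷ B))) (trans (cong c Q≡ByxA) (LP.map-++ swap B (y ∷ x ∷ A)))

  fibLyndon-long-short : ∀ m {u v} → IsFibLyndon (4 + m) u → IsFibLyndon (3 + m) v → Factor v u →
    Lyndon (u ++ v) → IsFibLyndon (5 + m) (u ++ v)
  fibLyndon-long-short m ru rv v⊑u L with p-split m | same-family m ru rv v⊑u
  ... | x , y , xy , e₁ , e₂ | inj₁ (refl , refl) =
    inj₁ (concat-lyndon (p (4 + m)) (p (3 + m)) (p (5 + m)) x y xy e₁ e₂ L)
  ... | x , y , xy , e₁ , e₂ | inj₂ (refl , refl) =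
    inj₂ (concat-lyndon-c (p (4 + m)) (p (3 + m)) (p (5 + m)) x y xy e₁ e₂ L)

  fibLyndon-short-long : ∀ m {u v} → IsFibLyndon (3 + m) u → IsFibLyndon (4 + m) v → Factor u v →
    Lyndon (u ++ v) → IsFibLyndon (5 + m) (u ++ v)
  fibLyndon-short-long m ru rv u⊑v L with p-split m | same-family m rv ru u⊑v
  ... | x , y , xy , e₁ , e₂ | inj₁ (refl , refl) =
    inj₁ (concat-lyndon (p (3 + m)) (p (4 + m)) (p (5 + m)) y x (flip-sym xy) e₂ e₁ L)
  ... | x , y , xy , e₁ , e₂ | inj₂ (refl , refl) =
    inj₂ (concat-lyndon-c (p (3 + m)) (p (4 + m)) (p (5 + m)) y x (flip-sym xy) e₂ e₁ L)

LyndonFactorsAtMost : Word k → ℕ → Set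
LyndonFactorsAtMost w n = ¬ LyndonFactors w (suc n)

atMost-factor : ∀ {x w : Word k} {n} → LyndonFactorsAtMost w (suc n) → Factor x w → length x < length w →
  Lyndon w → LyndonFactorsAtMost x n
atMost-factor w≤ x⊑w lt Lw Fx = w≤ (extend-by-word Fx x⊑w lt Lw)

atMost⇒length≤fib : ∀ {x : Word k} {n} → Lyndon x → LyndonFactorsAtMost x n → length x ≤ fib n
atMost⇒length≤fib {x = x} {n} Lx x≤ with fib n <? length x
... | yes F<|x| = ⊥-elim (x≤ (lyndonFactors-lower n x Lx F<|x|))
... | no F≮|x| = ≮⇒≥ F≮|x|

lengths-forced : ∀ U V A B → U + V ≡ A + B → U ≤ A → V ≤ B → U ≡ A × V ≡ B
lengths-forced U V A B e U≤A V≤B with m≤n⇒m<n∨m≡n U≤A | m≤n⇒m<n∨m≡n V≤B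
... | inj₂ U≡A | inj₂ V≡B = U≡A , V≡B
... | inj₁ U<A | _ = ⊥-elim (<-irrefl e (+-mono-<-≤ U<A V≤B))
... | inj₂ _ | inj₁ V<B = ⊥-elim (<-irrefl e (+-mono-≤-< U≤A V<B))

fib-≥2 : ∀ M → 2 ≤ fib (3 + M)
fib-≥2 zero = s≤s (s≤s z≤n)
fib-≥2 (suc M) = ≤-trans (fib-≥2 M) (m≤m+n _ _)

ExtremalPair : ℕ → Word k → Word k → Set
ExtremalPair M l s = length l ≡ fib (3 + M) × length s ≡ fib (2 + M) × Factor s l ×
  LyndonFactorsAtMost l (3 + M) × LyndonFactorsAtMost s (2 + M)

-- For the factors l, s of w (in either order) with |s| ≤ F_(M+2): the length bounds
-- force |l| = F_(M+3) and |s| = F_(M+2); if s were not inside l, or s had M+3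
-- Lyndon factors, then w would have M+5 of them (extend-by-two).
extremal-pair : ∀ M {w l s : Word k} → Lyndon w → Lyndon l → Lyndon s →
  Factor l w → Factor s w → length l < length w → length s < length w →
  length l + length s ≡ fib (3 + M) + fib (2 + M) → LyndonFactorsAtMost w (4 + M) →
  length s ≤ fib (2 + M) → ExtremalPair M l s
extremal-pair M {l = l} {s} Lw Ll Ls l⊑w s⊑w l<w s<w sum w≤ |s|≤F =
  |l|≡F , |s|≡F , s⊑l , l≤ , s≤
  where
  l≤ : LyndonFactorsAtMost l (3 + M)
  l≤ = atMost-factor w≤ l⊑w l<w Lw
  forced : length l ≡ fib (3 + M) × length s ≡ fib (2 + M)
  forced = lengths-forced (length l) (length s) (fib (3 + M)) (fib (2 + M)) sum (atMost⇒length≤fib Ll l≤) |s|≤F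
  |l|≡F : length l ≡ fib (3 + M)
  |l|≡F = proj₁ forced
  |s|≡F : length s ≡ fib (2 + M)
  |s|≡F = proj₂ forced
  |s|<|l| : length s < length l
  |s|<|l| = subst₂ _<_ (sym |s|≡F) (sym |l|≡F) (fib-< M)
  Fl : LyndonFactors l (3 + M)
  Fl = lyndonFactors-lower (2 + M) l Ll (subst (fib (2 + M) <_) (sym |l|≡F) (fib-< M))
  s⊑l : Factor s l
  s⊑l with factor? s l
  ... | yes s⊑l = s⊑l
  ... | no s⋢l = ⊥-elim (w≤ (extend-by-two Fl l⊑w l<w Ls s⊑w s⋢l s<w Lw))
  s≤ : LyndonFactorsAtMost s (2 + M)
  s≤ Fs = w≤ (extend-by-two Fs s⊑w s<w Ll l⊑w (λ l⊑s → <-irrefl refl (<-≤-trans |s|<|l| (factor-length l⊑s))) l<w Lw)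

extremal-factorisation : ∀ M (w : Word k) → Lyndon w → length w ≡ fib (4 + M) → LyndonFactorsAtMost w (4 + M) →
  ∃ λ u → ∃ λ v → w ≡ u ++ v × Lyndon u × Lyndon v × (ExtremalPair M u v ⊎ ExtremalPair M v u)
extremal-factorisation M w L |w|≡F w≤ with lyndon-factorisation L (subst (2 ≤_) (sym |w|≡F) (fib-≥2 (suc M)))
... | u , v , refl , Lu , Lv = u , v , refl , Lu , Lv , pair
  where
  sum : length u + length v ≡ fib (3 + M) + fib (2 + M)
  sum = trans (sym (LP.length-++ u)) |w|≡F
  pair : ExtremalPair M u v ⊎ ExtremalPair M v u
  pair with fib (2 + M) <? length u | fib (2 + M) <? length v
  ... | yes F<|u| | yes F<|v| =
    ⊥-elim (w≤ (extend-by-both (lyndonFactors-lower (2 + M) u Lu F<|u|) (lyndonFactors-lower (2 + M) v Lv F<|v|) Lu Lv L))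
  ... | _ | no F≮|v| = inj₁ (extremal-pair M L Lu Lv (factor-left u v) (factor-right u v)
      (length-<-left u v Lv) (length-<-right u v Lu) sum w≤ (≮⇒≥ F≮|v|))
  ... | no F≮|u| | yes _ = inj₂ (extremal-pair M L Lv Lu (factor-right u v) (factor-left u v)
      (length-<-right u v Lu) (length-<-left u v Lv) (trans (+-comm (length v) (length u)) sum) w≤ (≮⇒≥ F≮|u|))

all-factor : ∀ {P : Fin k → Set} {v u : Word k} → Factor v u → All P u → All P v
all-factor {v = v} (x , y , refl) all = AllP.++⁻ˡ v (AllP.++⁻ʳ x all)

module _ {a b : Fin k} (a<b : a <F b) where
  open FibonacciWords a b a<b

  fibLyndon-overAB : ∀ {n u} → IsFibLyndon n u → All OverAB u
  fibLyndon-overAB {n} (inj₁ refl) = X-overAB n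
  fibLyndon-overAB {n} (inj₂ refl) = Y-overAB n

  -- A Fibonacci Lyndon word  v  over a′ < b′ inside one over a < b starts with a′
  -- and ends with b′, both in {a, b}; hence a′ = a and b′ = b.
  same-letters : ∀ {a′ b′ : Fin k} (a′<b′ : a′ <F b′) {m n} {u v : Word k} →
    IsFibLyndon m u → FibonacciWords.IsFibLyndon a′ b′ a′<b′ n v → Factor v u → a′ ≡ a × b′ ≡ b
  same-letters {a′} {b′} a′<b′ {m} {n} {v = v} ru rv v⊑u = pin (ends rv (all-factor v⊑u (fibLyndon-overAB {m} ru)))
    where
    open FibonacciWords a′ b′ a′<b′ using () renaming (p to p′; c to c′)
    ends : FibonacciWords.IsFibLyndon a′ b′ a′<b′ n v → All OverAB v → OverAB a′ × OverAB b′
    ends (inj₁ refl) (ha ∷ rest) with AllP.++⁻ʳ (p′ n) rest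
    ... | hb ∷ [] = ha , hb
    ends (inj₂ refl) (ha ∷ rest) with AllP.++⁻ʳ (c′ (p′ n)) rest
    ... | hb ∷ [] = ha , hb
    pin : OverAB a′ × OverAB b′ → a′ ≡ a × b′ ≡ b
    pin (inj₁ refl , inj₁ refl) = ⊥-elim (FP.<-irrefl refl a′<b′)
    pin (inj₁ refl , inj₂ refl) = refl , refl
    pin (inj₂ refl , inj₁ refl) = ⊥-elim (FP.<-asym a<b a′<b′)
    pin (inj₂ refl , inj₂ refl) = ⊥-elim (FP.<-irrefl refl a′<b′)

  -- Length 3: the Lyndon words  ab z  and  z ab  with z a letter of ab are  abb = Y 4  and  aab = X 4.
  fibLyndon-3-is-ab : ∀ {u} → IsFibLyndon 3 u → u ≡ a ∷ b ∷ []
  fibLyndon-3-is-ab (inj₁ e) = e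
  fibLyndon-3-is-ab (inj₂ e) = e

  ab-then-letter : ∀ z → Factor (z ∷ []) (a ∷ b ∷ []) → Lyndon (a ∷ b ∷ z ∷ []) →
    IsFibLyndon 4 (a ∷ b ∷ z ∷ [])
  ab-then-letter z z⊑ab L with all-factor z⊑ab (X-overAB 3)
  ... | inj₁ refl ∷ [] = ⊥-elim (lyndon-rotation (a ∷ b ∷ []) (a ∷ []) L refl (there (here a<b)))
  ... | inj₂ refl ∷ [] = inj₂ (cong (λ t → a ∷ t ∷ b ∷ []) (sym swap-a))

  letter-then-ab : ∀ z → Factor (z ∷ []) (a ∷ b ∷ []) → Lyndon (z ∷ a ∷ b ∷ []) →
    IsFibLyndon 4 (z ∷ a ∷ b ∷ [])
  letter-then-ab z z⊑ab L with all-factor z⊑ab (X-overAB 3)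
  ... | inj₁ refl ∷ [] = inj₁ refl
  ... | inj₂ refl ∷ [] = ⊥-elim (lyndon-rotation (b ∷ []) (a ∷ b ∷ []) L refl (here a<b))

Characterised : ℕ → ℕ → Set
Characterised k n = ∀ (u : Word k) → Lyndon u → length u ≡ fib n → LyndonFactorsAtMost u n → FibonacciLyndon n u

characterised-3 : Characterised k 3
characterised-3 (x ∷ y ∷ []) L _ _ with FP.<-cmp x y
... | tri< x<y _ _ = x , y , x<y , inj₁ refl
... | tri≈ _ refl _ with proj₁ (proj₂ L) (x ∷ []) 2 refl
... | ()
characterised-3 (x ∷ y ∷ []) L _ _ | tri> _ _ y<x = ⊥-elim (lyndon-rotation (x ∷ []) (y ∷ []) L refl (here y<x))

singleton : ∀ (v : Word k) → length v ≡ 1 → ∃ λ z → v ≡ z ∷ []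
singleton (z ∷ []) _ = z , refl

-- n = 4: the longer standard factor is  ab  and the shorter a letter inside it.
characterised-4 : Characterised k 4
characterised-4 w L |w|≡3 w≤ with extremal-factorisation 0 w L |w|≡3 w≤
... | u , v , refl , Lu , _ , inj₁ (|u|≡2 , |v|≡1 , v⊑u , u≤ , _)
  with characterised-3 u Lu |u|≡2 u≤ | singleton v |v|≡1
... | a , b , a<b , ru | z , refl with fibLyndon-3-is-ab a<b ru
... | refl = a , b , a<b , ab-then-letter a<b z v⊑u L
characterised-4 w L |w|≡3 w≤ | u , v , refl , _ , Lv , inj₂ (|v|≡2 , |u|≡1 , u⊑v , v≤ , _)
  with characterised-3 v Lv |v|≡2 v≤ | singleton u |u|≡1
... | a , b , a<b , rv | z , refl with fibLyndon-3-is-ab a<b rv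
... | refl = a , b , a<b , letter-then-ab a<b z u⊑v L

-- n ≥ 5: both standard factors are Fibonacci Lyndon words by induction, over the same
-- letters since the shorter occurs in the longer; their Lyndon product is the next one.
characterised-step : ∀ m → Characterised k (4 + m) → Characterised k (3 + m) → Characterised k (5 + m)
characterised-step m ih₄ ih₃ w L |w|≡F w≤ with extremal-factorisation (suc m) w L |w|≡F w≤
... | u , v , refl , Lu , Lv , inj₁ (|u|≡F , |v|≡F , v⊑u , u≤ , v≤)
  with ih₄ u Lu |u|≡F u≤ | ih₃ v Lv |v|≡F v≤
... | a , b , a<b , ru | a′ , b′ , a′<b′ , rv with same-letters a<b a′<b′ {4 + m} {3 + m} ru rv v⊑u
... | refl , refl = a , b , a<b , FibonacciWords.fibLyndon-long-short a b a<b m ru rv v⊑u L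
characterised-step m ih₄ ih₃ w L |w|≡F w≤ | u , v , refl , Lu , Lv , inj₂ (|v|≡F , |u|≡F , u⊑v , v≤ , u≤)
  with ih₃ u Lu |u|≡F u≤ | ih₄ v Lv |v|≡F v≤
... | a′ , b′ , a′<b′ , ru | a , b , a<b , rv with same-letters a<b a′<b′ {4 + m} {3 + m} rv ru u⊑v
... | refl , refl = a , b , a<b , FibonacciWords.fibLyndon-short-long a b a<b m ru rv u⊑v L

characterised : ∀ n → 3 ≤ n → Characterised k n
characterised zero ()
characterised (suc zero) (s≤s ())
characterised (suc (suc zero)) (s≤s (s≤s ()))
characterised (suc (suc (suc zero))) _ = characterised-3
characterised (suc (suc (suc (suc zero)))) _ = characterised-4
characterised (suc (suc (suc (suc (suc m))))) _ =
  characterised-step m (characterised (suc (suc (suc (suc m)))) (s≤s (s≤s (s≤s z≤n))))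
                       (characterised (suc (suc (suc m))) (s≤s (s≤s (s≤s z≤n))))

lyndonFactors-≤ : ∀ {w : Word k} {j m} → LyndonFactors w j → NumLyndonFactors w m → j ≤ m
lyndonFactors-≤ (ls , uniq , refl , all) (ls′ , _ , refl , iff) =
  unique-length-≤ ls ls′ uniq (All.map (λ {y} y-factor → Equivalence.from (iff y) y-factor) all)

-- Lemma 1.1: the lower bound is the pigeonhole applied to lyndonFactors-lower; if
-- 𝓛(w) = n then w is extremal, so |w| = F_n and the characterisation applies.
lemma11 : (k : ℕ) (w : Word k) (n : ℕ) → 3 ≤ n → Lyndon w → fib n ≤ length w →
    (m : ℕ) → NumLyndonFactors w m → n ≤ m × (m ≡ n → FibonacciLyndon n w)
lemma11 _ _ zero () _ _ _ _
lemma11 _ _ (suc zero) (s≤s ()) _ _ _ _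
lemma11 _ _ (suc (suc zero)) (s≤s (s≤s ())) _ _ _ _
lemma11 k w n@(suc (suc (suc j))) 3≤n L F≤|w| m 𝓛≡m = lower , extremal
  where
  lower : n ≤ m
  lower = lyndonFactors-≤ (lyndonFactors-lower (2 + j) w L (<-≤-trans (fib-< j) F≤|w|)) 𝓛≡m
  extremal : m ≡ n → FibonacciLyndon n w
  extremal refl = characterised n 3≤n w L |w|≡F w≤
    where
    w≤ : LyndonFactorsAtMost w n
    w≤ Fw = <-irrefl refl (lyndonFactors-≤ Fw 𝓛≡m)
    |w|≡F : length w ≡ fib n
    |w|≡F = ≤-antisym (atMost⇒length≤fib L w≤) F≤|w|
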